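{- Let $m\geq 1$ and let $K_{m,2}$ be the complete bipartite graph with parts $\{v_0,v_1,\ldots,v_{m-1}\}$ and $\{v_m,v_{m+1}\}$, with sink $v_0$. For a configuration $c=(c_1,\ldots,c_{m+1})$ let $X=\{i\in[1,m-1] : c_i=0\}$. Then $$\mathsf{Sto}(K_{m,2})=\{(c_1,\ldots,c_{m+1}) : c_1,\ldots,c_{m-1}\in\{0,1\},\ 0\leq c_m,c_{m+1}\leq m-1,\ c_m+c_{m+1}\geq m-1+|X|\}.$$
   Context: Let $G$ be a finite connected loop-free graph with a distinguished sink vertex $s$. A configuration assigns a non-negative integer $c(v)$ to each non-sink vertex $v$; it is stable if $c(v)<d(v)$ for every non-sink $v$, where $d(v)$ is the degree. For an orientation $\mathcal{O}$ of $G$, $\mathrm{in}_{\mathcal{O}}(v)$ is the number of edges directed into $v$; $c$ is compatible with $\mathcal{O}$ if $\mathrm{in}_{\mathcal{O}}(v)\geq d(v)-c(v)$ for every non-sink $v$. The set $\mathsf{Sto}(G)$ of stochastically recurrent states is the set of stable configurations compatible with at least one orientation of $G$. We write $c_i=c(v_i)$ and $[a,b]=\{a,\ldots,b\}$. -}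

module Defs where

open import Data.Nat using (ℕ; zero; suc; _+_; _*_; _∸_; _≤_; _<_)
open import Data.Bool using (Bool; true; false; if_then_else_)
open import Data.Fin using (Fin; zero; suc; inject₁; fromℕ; remQuot; _≟_)
open import Data.Product using (_×_; _,_; proj₁; proj₂; Σ)
open import Relation.Nullary.Decidable using (⌊_⌋)

count : ∀ {n} → (Fin n → Bool) → ℕ
count {zero}  p = 0
count {suc n} p = (if p zero then 1 else 0) + count (λ i → p (suc i))

-- A finite (multi)graph with vertex set Fin (suc nV); vertex zero is the sink s,
-- the non-sink vertices are suc i for i : Fin nV.
record Graph : Set where
  field
    nV   : ℕ
    nE   : ℕ
    ends : Fin nE → Fin (suc nV) × Fin (suc nV)

module _ (G : Graph) where
  open Graph G

  _==_ : Fin (suc nV) → Fin (suc nV) → Bool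
  u == v = ⌊ u ≟ v ⌋

  -- degree: number of edge-endpoints equal to v (graphs are loop-free)
  deg : Fin (suc nV) → ℕ
  deg v = count (λ e → proj₁ (ends e) == v) + count (λ e → proj₂ (ends e) == v)

  -- an orientation chooses a direction for each edge:
  -- true: proj₁ → proj₂ ; false: proj₂ → proj₁
  Orientation : Set
  Orientation = Fin nE → Bool

  head : Orientation → Fin nE → Fin (suc nV)
  head O e = if O e then proj₂ (ends e) else proj₁ (ends e)

  indeg : Orientation → Fin (suc nV) → ℕ
  indeg O v = count (λ e → head O e == v)

  -- configurations on non-sink vertices: c i = c(suc i)
  Config : Set
  Config = Fin nV → ℕ

  Stable : Config → Set
  Stable c = ∀ i → c i < deg (suc i)

  Compatible : Orientation → Config → Set
  Compatible O c = ∀ i → deg (suc i) ∸ c i ≤ indeg O (suc i)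

  Sto : Config → Set
  Sto c = Stable c × Σ Orientation (λ O → Compatible O c)

-- second part of K_{m,2}: index 0 ↦ v_m, index 1 ↦ v_{m+1}
bigPart : ∀ m → Fin 2 → Fin (suc (suc m))
bigPart m zero       = inject₁ (fromℕ m)
bigPart m (suc zero) = fromℕ (suc m)

-- K_{m,2} with vertices v_0..v_{m+1} (v_j = the element of Fin (m+2) with toℕ j),
-- parts {v_0..v_{m-1}} and {v_m, v_{m+1}}, sink v_0; edges indexed by Fin (m * 2).
K : ℕ → Graph
K m = record
  { nV = suc m
  ; nE = m * 2
  ; ends = λ e → let (i , j) = remQuot 2 e in (inject₁ (inject₁ i) , bigPart m j)
  }

{-# OPTIONS --safe #-}
module Submission where

open import Defs
open import Data.Bool using (Bool; true; false; not; _∧_; _∨_; if_then_else_; b≤b; f≤t)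
  renaming (_≤_ to _≤ᵇ_)
open import Data.Bool.Properties using (∧-zeroʳ; ∧-inverseʳ; ∨-inverseʳ; ≤-minimum)
open import Data.Fin using (Fin; zero; suc; inject₁; fromℕ; _↑ˡ_; _↑ʳ_; remQuot; combine)
open import Data.Fin.Properties
  using (_≟_; suc-injective; inject₁-injective; fromℕ≢inject₁; combine-remQuot)
open import Data.Nat using (ℕ; zero; suc; _+_; _∸_; _≤_; _<_; _≡ᵇ_; z≤n; s≤s)
open import Data.Nat.Properties
  using (≤-refl; ≤-pred; ≤-trans; ≤-reflexive; m≤n⇒m≤1+n; m≤m+n; m≤n+m∸n;
         +-assoc; +-comm; +-identityʳ; +-commutativeSemigroup; +-mono-≤; +-monoˡ-≤; +-monoʳ-≤;
         +-cancelˡ-≤; +-cancelʳ-≤; ∸-monoʳ-≤; +-∸-assoc; m∸n+n≡m; m+n∸m≡n;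
         module ≤-Reasoning)
open import Data.Nat.Tactic.RingSolver using (solve-∀)
open import Algebra.Properties.CommutativeSemigroup +-commutativeSemigroup using (interchange)
open import Data.Product using (Σ; _×_; _,_; proj₁; proj₂; uncurry)
open import Data.Vec.Functional using (_∷_; [])
open import Function using (_∘_)
open import Function.Bundles using (_⇔_; mk⇔; Equivalence)
open import Function.Construct.Identity using (⇔-id)
open import Relation.Binary.PropositionalEquality
open import Relation.Nullary using (contradiction)
open import Relation.Nullary.Decidable using (⌊_⌋)

-- A non-sink small vertex has degree 2, so compatibility there says that it sends at most c_i
-- edges to the big part, while v_m and v_{m+1} have degree m and must each receive at least
-- m - c_m, resp. m - c_{m+1}, edges. The sink sends both its edges, so it remains to cover the
-- deficits (m-1-c_m) + (m-1-c_{m+1}) by non-sink small vertices sending one edge each; only those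
-- with c_i = 1 may do so, and there are m-1-|X| of them. Counting gives necessity; sending the
-- edges of the right number of these vertices to v_m and of the others to v_{m+1} gives
-- sufficiency.

indicator : Bool → ℕ
indicator b = if b then 1 else 0

indicator-≤-1 : ∀ b → indicator b ≤ 1
indicator-≤-1 true  = ≤-refl
indicator-≤-1 false = z≤n

count-cong : ∀ {n} {p q : Fin n → Bool} → (∀ i → p i ≡ q i) → count p ≡ count q
count-cong {zero}  p≗q = refl
count-cong {suc n} p≗q = cong₂ _+_ (cong indicator (p≗q zero)) (count-cong (p≗q ∘ suc))

count-none : ∀ {n} {p : Fin n → Bool} → (∀ i → p i ≡ false) → count p ≡ 0
count-none {zero}  p≗false = refl
count-none {suc n} p≗false rewrite p≗false zero = count-none (p≗false ∘ suc)

count-all : ∀ {n} {p : Fin n → Bool} → (∀ i → p i ≡ true) → count p ≡ n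
count-all {zero}  p≗true = refl
count-all {suc n} p≗true rewrite p≗true zero = cong suc (count-all (p≗true ∘ suc))

count-≤ : ∀ {n} (p : Fin n → Bool) → count p ≤ n
count-≤ {zero}  p = z≤n
count-≤ {suc n} p with p zero
... | true  = s≤s (count-≤ (p ∘ suc))
... | false = m≤n⇒m≤1+n (count-≤ (p ∘ suc))

count-∨-∧ : ∀ {n} (p q : Fin n → Bool) →
            count (λ i → p i ∨ q i) + count (λ i → p i ∧ q i) ≡ count p + count q
count-∨-∧ {zero}  p q = refl
count-∨-∧ {suc n} p q = begin
  (indicator (p zero ∨ q zero) + count (λ i → p′ i ∨ q′ i))
    + (indicator (p zero ∧ q zero) + count (λ i → p′ i ∧ q′ i))
      ≡⟨ interchange (indicator (p zero ∨ q zero)) _ _ _ ⟩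
  (indicator (p zero ∨ q zero) + indicator (p zero ∧ q zero))
    + (count (λ i → p′ i ∨ q′ i) + count (λ i → p′ i ∧ q′ i))
      ≡⟨ cong₂ _+_ (indicator-∨-∧ (p zero) (q zero)) (count-∨-∧ p′ q′) ⟩
  (indicator (p zero) + indicator (q zero)) + (count p′ + count q′)
      ≡⟨ interchange (indicator (p zero)) _ _ _ ⟩
  (indicator (p zero) + count p′) + (indicator (q zero) + count q′)
      ∎
  where
  open ≡-Reasoning
  p′ q′ : Fin n → Bool
  p′ = p ∘ suc
  q′ = q ∘ suc
  indicator-∨-∧ : ∀ x y → indicator (x ∨ y) + indicator (x ∧ y) ≡ indicator x + indicator y
  indicator-∨-∧ true  true  = refl
  indicator-∨-∧ true  false = refl
  indicator-∨-∧ false true  = refl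
  indicator-∨-∧ false false = refl

count-disjoint : ∀ {n} {p q : Fin n → Bool} → (∀ i → p i ∧ q i ≡ false) →
                 count p + count q ≡ count (λ i → p i ∨ q i)
count-disjoint {p = p} {q} disjoint = begin
  count p + count q                                   ≡⟨ count-∨-∧ p q ⟨
  count (λ i → p i ∨ q i) + count (λ i → p i ∧ q i)  ≡⟨ cong (count p∨q +_) (count-none disjoint) ⟩
  count (λ i → p i ∨ q i) + 0                        ≡⟨ +-identityʳ _ ⟩
  count (λ i → p i ∨ q i)                            ∎
  where
  open ≡-Reasoning
  p∨q : Fin _ → Bool
  p∨q i = p i ∨ q i

count-not : ∀ {n} (p : Fin n → Bool) → count p + count (not ∘ p) ≡ n
count-not p = trans (count-disjoint (∧-inverseʳ ∘ p)) (count-all (∨-inverseʳ ∘ p))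

count-⊆-split : ∀ {n} {p r : Fin n → Bool} → (∀ i → p i ≤ᵇ r i) →
                count p + count (λ i → r i ∧ not (p i)) ≡ count r
count-⊆-split p⊆r = trans (count-disjoint (disjoint ∘ p⊆r)) (count-cong (union ∘ p⊆r))
  where
  disjoint : ∀ {x y} → x ≤ᵇ y → x ∧ (y ∧ not x) ≡ false
  disjoint f≤t           = refl
  disjoint (b≤b {true})  = refl
  disjoint (b≤b {false}) = refl
  union : ∀ {x y} → x ≤ᵇ y → x ∨ (y ∧ not x) ≡ y
  union f≤t           = refl
  union (b≤b {true})  = refl
  union (b≤b {false}) = refl

count-choose : ∀ {n} (r : Fin n → Bool) {a} → a ≤ count r →
               Σ (Fin n → Bool) λ p → (∀ i → p i ≤ᵇ r i) × count p ≡ a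
count-choose {n} r {zero} _ = (λ _ → false) , ≤-minimum ∘ r , count-none {n} (λ _ → refl)
count-choose {suc n} r {suc a} a<r with r zero in r₀
... | true  = let (p , p⊆r , |p|≡a) = count-choose (r ∘ suc) (≤-pred a<r)
              in true ∷ p ,
                 (λ { zero → subst (true ≤ᵇ_) (sym r₀) b≤b ; (suc i) → p⊆r i }) ,
                 cong suc |p|≡a
... | false = let (p , p⊆r , |p|≡a) = count-choose (r ∘ suc) a<r
              in false ∷ p , (λ { zero → ≤-minimum (r zero) ; (suc i) → p⊆r i }) , |p|≡a

count-↑ : ∀ m {n} (p : Fin (m + n) → Bool) →
          count p ≡ count (λ i → p (i ↑ˡ n)) + count (λ i → p (m ↑ʳ i))
count-↑ zero    p = refl
count-↑ (suc m) p =
  trans (cong (indicator (p zero) +_) (count-↑ m (p ∘ suc))) (sym (+-assoc (indicator (p zero)) _ _))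

count-remQuot : ∀ {n} (q : Fin n → Fin 2 → Bool) →
                count (λ e → uncurry q (remQuot {n} 2 e))
                  ≡ count (λ i → q i zero) + count (λ i → q i (suc zero))
count-remQuot {zero}  q = refl
count-remQuot {suc n} q = begin
  count (λ e → uncurry q (remQuot {suc n} 2 e))
    ≡⟨ count-↑ 2 (λ e → uncurry q (remQuot {suc n} 2 e)) ⟩
  count (q zero) + count (λ e → uncurry (q ∘ suc) (remQuot {n} 2 e))
    ≡⟨ cong (count (q zero) +_) (count-remQuot (q ∘ suc)) ⟩
  count (q zero) + (count (λ i → q (suc i) zero) + count (λ i → q (suc i) (suc zero)))
    ≡⟨ rearrange (indicator (q zero zero)) (indicator (q zero (suc zero))) _ _ ⟩
  count (λ i → q i zero) + count (λ i → q i (suc zero))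
    ∎
  where
  open ≡-Reasoning
  rearrange : ∀ a b x y → (a + (b + 0)) + (x + y) ≡ (a + x) + (b + y)
  rearrange = solve-∀

count-remQuot-row : ∀ {n} (q : Fin n → Fin 2 → Bool) t → (∀ i j → i ≢ t → q i j ≡ false) →
                    count (λ e → uncurry q (remQuot {n} 2 e)) ≡ count (q t)
count-remQuot-row {suc n} q zero    off =
  trans (count-↑ 2 (λ e → uncurry q (remQuot {suc n} 2 e)))
    (trans (cong (count (q zero) +_) (count-none other-rows)) (+-identityʳ _))
  where
  other-rows : ∀ e → uncurry (q ∘ suc) (remQuot {n} 2 e) ≡ false
  other-rows e = off (suc (proj₁ (remQuot {n} 2 e))) (proj₂ (remQuot {n} 2 e)) λ ()
count-remQuot-row {suc n} q (suc t) off =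
  trans (count-↑ 2 (λ e → uncurry q (remQuot {suc n} 2 e)))
    (cong₂ _+_ (count-none (λ j → off zero j λ ()))
      (count-remQuot-row (q ∘ suc) t (λ i j i≢t → off (suc i) j (i≢t ∘ suc-injective))))

m∸n≤m∸o⇔o≤n : ∀ {m n o} → o ≤ m → (m ∸ n ≤ m ∸ o ⇔ o ≤ n)
m∸n≤m∸o⇔o≤n {m} {n} {o} o≤m = mk⇔ cancel (∸-monoʳ-≤ m)
  where
  open ≤-Reasoning
  cancel : m ∸ n ≤ m ∸ o → o ≤ n
  cancel le = +-cancelˡ-≤ (m ∸ n) o n (begin
    m ∸ n + o  ≤⟨ +-monoˡ-≤ o le ⟩
    m ∸ o + o  ≡⟨ m∸n+n≡m o≤m ⟩
    m          ≤⟨ m≤n+m∸n m n ⟩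
    n + (m ∸ n) ≡⟨ +-comm n (m ∸ n) ⟩
    m ∸ n + n  ∎)

m∸n+[m∸o]+p≤m⇔m+p≤n+o : ∀ {m n o p} → n ≤ m → o ≤ m →
                         (m ∸ n + (m ∸ o) + p ≤ m ⇔ m + p ≤ n + o)
m∸n+[m∸o]+p≤m⇔m+p≤n+o {m} {n} {o} {p} n≤m o≤m = mk⇔
  (λ le → +-cancelˡ-≤ m _ _ (≤-trans (≤-reflexive (sym balance)) (+-monoˡ-≤ (n + o) le)))
  (λ le → +-cancelʳ-≤ (n + o) _ _ (≤-trans (≤-reflexive balance) (+-monoʳ-≤ m le)))
  where
  open ≡-Reasoning
  rearrange : ∀ a b p n o → a + b + p + (n + o) ≡ (a + n) + ((b + o) + p)
  rearrange = solve-∀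
  balance : m ∸ n + (m ∸ o) + p + (n + o) ≡ m + (m + p)
  balance = begin
    m ∸ n + (m ∸ o) + p + (n + o)
      ≡⟨ rearrange (m ∸ n) (m ∸ o) p n o ⟩
    (m ∸ n + n) + ((m ∸ o + o) + p)
      ≡⟨ cong₂ (λ x y → x + (y + p)) (m∸n+n≡m n≤m) (m∸n+n≡m o≤m) ⟩
    m + (m + p)
      ∎

count-not-≥⇔count-≤ : ∀ {n} (p : Fin n → Bool) c →
                      (n ∸ c ≤ count (not ∘ p) ⇔ count p ≤ c)
count-not-≥⇔count-≤ {n} p c =
  subst (λ x → n ∸ c ≤ x ⇔ count p ≤ c) complement (m∸n≤m∸o⇔o≤n (count-≤ p))
  where
  complement : n ∸ count p ≡ count (not ∘ p)
  complement = trans (cong (_∸ count p) (sym (count-not p))) (m+n∸m≡n (count p) _)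

∸-≤-count-tail : ∀ {k c n} (p : Fin (suc n) → Bool) → c ≤ k →
                 suc k ∸ c ≤ count p → k ∸ c ≤ count (p ∘ suc)
∸-≤-count-tail {k} {c} p c≤k le = ≤-pred (begin
  suc (k ∸ c)            ≡⟨ +-∸-assoc 1 c≤k ⟨
  suc k ∸ c              ≤⟨ le ⟩
  count p                ≤⟨ +-monoˡ-≤ (count (p ∘ suc)) (indicator-≤-1 (p zero)) ⟩
  suc (count (p ∘ suc))  ∎)
  where open ≤-Reasoning

∸-≤-count-true∷ : ∀ {k c n} (p : Fin n → Bool) → c ≤ k →
                  k ∸ c ≤ count p → suc k ∸ c ≤ count (true ∷ p)
∸-≤-count-true∷ p c≤k le = ≤-trans (≤-reflexive (+-∸-assoc 1 c≤k)) (s≤s le)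

module _ {n} (cap : Fin n → ℕ) where

  idle : Fin n → Bool
  idle t = cap t ≡ᵇ 0

  column-counts-≤ : (h : Fin n → Fin 2 → Bool) →
                    (∀ t → cap t ≤ 1) → (∀ t → count (h t) ≤ cap t) →
                    count (λ t → h t zero) + count (λ t → h t (suc zero)) + count idle ≤ n
  column-counts-≤ h cap≤1 h≤cap = begin
    count (λ t → h t zero) + count (λ t → h t (suc zero)) + count idle
      ≡⟨ cong (_+ count idle) (count-disjoint (λ t → single-edge (h t) (cap≤1 t) (h≤cap t))) ⟩
    count busy + count idle
      ≡⟨ count-disjoint (λ t → busy-not-idle (h t) (h≤cap t)) ⟩
    count (λ t → busy t ∨ idle t)
      ≤⟨ count-≤ _ ⟩
    n ∎
    where
    open ≤-Reasoning
    busy : Fin n → Bool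
    busy t = h t zero ∨ h t (suc zero)
    single-edge : ∀ (q : Fin 2 → Bool) {c} → c ≤ 1 → count q ≤ c →
                  q zero ∧ q (suc zero) ≡ false
    single-edge q c≤1 q≤c with q zero | q (suc zero)
    ... | true  | true  = contradiction (≤-trans q≤c c≤1) λ { (s≤s ()) }
    ... | true  | false = refl
    ... | false | _     = refl
    busy-not-idle : ∀ (q : Fin 2 → Bool) {c} → count q ≤ c →
                    (q zero ∨ q (suc zero)) ∧ (c ≡ᵇ 0) ≡ false
    busy-not-idle q {suc c} _ = ∧-zeroʳ _
    busy-not-idle q {zero} q≤0 with q zero | q (suc zero)
    ... | false | false = refl
    ... | true  | _     = contradiction q≤0 λ ()
    ... | false | true  = contradiction q≤0 λ ()

  column-counts-realisable :
    ∀ {a b} → a + b + count idle ≤ n →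
    Σ (Fin n → Fin 2 → Bool) λ h →
      (∀ t → count (h t) ≤ cap t) ×
      a ≤ count (λ t → h t zero) × b ≤ count (λ t → h t (suc zero))
  column-counts-realisable {a} {b} fits =
    let (p , p⊆active , |p|≡a) = count-choose active a≤active
    in (λ t → p t ∷ (active t ∧ not (p t)) ∷ []) ,
       (λ t → row-fits (cap t) (p⊆active t)) ,
       ≤-reflexive (sym |p|≡a) ,
       b≤rest p⊆active |p|≡a
    where
    open ≤-Reasoning
    active : Fin n → Bool
    active t = not (idle t)
    a+b≤active : a + b ≤ count active
    a+b≤active = +-cancelʳ-≤ (count idle) (a + b) (count active) (begin
      a + b + count idle       ≤⟨ fits ⟩
      n                        ≡⟨ count-not idle ⟨
      count idle + count active ≡⟨ +-comm (count idle) _ ⟩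
      count active + count idle ∎)
    a≤active : a ≤ count active
    a≤active = ≤-trans (m≤m+n a b) a+b≤active
    b≤rest : ∀ {p} → (∀ t → p t ≤ᵇ active t) → count p ≡ a →
             b ≤ count (λ t → active t ∧ not (p t))
    b≤rest {p} p⊆active |p|≡a = +-cancelˡ-≤ a b _ (begin
      a + b                 ≤⟨ a+b≤active ⟩
      count active          ≡⟨ count-⊆-split p⊆active ⟨
      count p + count rest  ≡⟨ cong (_+ count rest) |p|≡a ⟩
      a + count rest        ∎)
      where
      rest : Fin n → Bool
      rest t = active t ∧ not (p t)
    row-fits : ∀ c {x} → x ≤ᵇ not (c ≡ᵇ 0) → count (x ∷ (not (c ≡ᵇ 0) ∧ not x) ∷ []) ≤ c
    row-fits zero    b≤b       = z≤n
    row-fits (suc c) {true}  _ = s≤s z≤n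
    row-fits (suc c) {false} _ = s≤s z≤n

small : ∀ {m} → Fin m → Fin (suc (suc m))
small i = inject₁ (inject₁ i)

edgeHead : ∀ {m} → Bool → Fin m → Fin 2 → Fin (suc (suc m))
edgeHead x i j = if x then bigPart _ j else small i

pairOrientation : ∀ m → (Fin m → Fin 2 → Bool) → Orientation (K m)
pairOrientation m P e = uncurry P (remQuot {m} 2 e)

small-injective : ∀ {m} {i i′ : Fin m} → small i ≡ small i′ → i ≡ i′
small-injective = inject₁-injective ∘ inject₁-injective

bigPart-injective : ∀ {m} {j j′ : Fin 2} → bigPart m j ≡ bigPart m j′ → j ≡ j′
bigPart-injective {j = zero}     {zero}     _  = refl
bigPart-injective {j = zero}     {suc zero} eq = contradiction (sym eq) fromℕ≢inject₁
bigPart-injective {j = suc zero} {zero}     eq = contradiction eq fromℕ≢inject₁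
bigPart-injective {j = suc zero} {suc zero} _  = refl

bigPart≢small : ∀ {m} j (i : Fin m) → bigPart m j ≢ small i
bigPart≢small zero       i eq = fromℕ≢inject₁ (inject₁-injective eq)
bigPart≢small (suc zero) i eq = fromℕ≢inject₁ eq

≟-self : ∀ {n} (u : Fin n) → ⌊ u ≟ u ⌋ ≡ true
≟-self u = cong ⌊_⌋ (≡-≟-identity _≟_ refl)

≟-≢ : ∀ {n} {u v : Fin n} → u ≢ v → ⌊ u ≟ v ⌋ ≡ false
≟-≢ u≢v = cong ⌊_⌋ (≢-≟-identity _≟_ u≢v)

edgeHead-≟-big : ∀ {m} x (i : Fin m) j → ⌊ edgeHead x i j ≟ bigPart m j ⌋ ≡ x
edgeHead-≟-big true  i j = ≟-self _
edgeHead-≟-big false i j = ≟-≢ (bigPart≢small j i ∘ sym)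

edgeHead-≟-otherBig : ∀ {m} x (i : Fin m) j j′ → j ≢ j′ →
                      ⌊ edgeHead x i j ≟ bigPart m j′ ⌋ ≡ false
edgeHead-≟-otherBig true  i j j′ j≢j′ = ≟-≢ (j≢j′ ∘ bigPart-injective)
edgeHead-≟-otherBig false i j j′ _    = ≟-≢ (bigPart≢small j′ i ∘ sym)

edgeHead-≟-small : ∀ {m} x (t : Fin m) j → ⌊ edgeHead x t j ≟ small t ⌋ ≡ not x
edgeHead-≟-small true  t j = ≟-≢ (bigPart≢small j t)
edgeHead-≟-small false t j = ≟-self _

edgeHead-≟-otherSmall : ∀ {m} x {i t : Fin m} j → i ≢ t →
                        ⌊ edgeHead x i j ≟ small t ⌋ ≡ false
edgeHead-≟-otherSmall true  {t = t} j _ = ≟-≢ (bigPart≢small j t)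
edgeHead-≟-otherSmall false j i≢t = ≟-≢ (i≢t ∘ small-injective)

module _ (m : ℕ) (P : Fin m → Fin 2 → Bool) where

  pointsTo : Fin (suc (suc m)) → Fin m → Fin 2 → Bool
  pointsTo v i j = ⌊ edgeHead (P i j) i j ≟ v ⌋

  indeg-pair-big : ∀ j → indeg (K m) (pairOrientation m P) (bigPart m j) ≡ count (λ i → P i j)
  indeg-pair-big zero =
    trans (count-remQuot (pointsTo (bigPart m zero)))
      (trans (cong₂ _+_ (count-cong λ i → edgeHead-≟-big (P i zero) i zero)
                        (count-none λ i → edgeHead-≟-otherBig (P i (suc zero)) i (suc zero) zero λ ()))
             (+-identityʳ _))
  indeg-pair-big (suc zero) =
    trans (count-remQuot (pointsTo (bigPart m (suc zero))))
      (cong₂ _+_ (count-none λ i → edgeHead-≟-otherBig (P i zero) i zero (suc zero) λ ())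
                 (count-cong λ i → edgeHead-≟-big (P i (suc zero)) i (suc zero)))

  indeg-pair-small : ∀ t → indeg (K m) (pairOrientation m P) (small t) ≡ count (λ j → not (P t j))
  indeg-pair-small t =
    trans (count-remQuot-row (pointsTo (small t)) t (λ i j → edgeHead-≟-otherSmall (P i j) j))
      (count-cong λ j → edgeHead-≟-small (P t j) t j)

deg-big : ∀ m j → deg (K m) (bigPart m j) ≡ m
deg-big m j =
  trans (cong₂ _+_ (indeg-pair-big m (λ _ _ → false) j) (indeg-pair-big m (λ _ _ → true) j))
        (cong₂ _+_ (count-none {m} (λ _ → refl)) (count-all (λ _ → refl)))

deg-small : ∀ m (t : Fin m) → deg (K m) (small t) ≡ 2
deg-small m t = cong₂ _+_ (indeg-pair-small m (λ _ _ → false) t) (indeg-pair-small m (λ _ _ → true) t)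

indeg-cong : ∀ G {O O′ : Orientation G} → (∀ e → O e ≡ O′ e) →
             ∀ v → indeg G O v ≡ indeg G O′ v
indeg-cong G O≗O′ v =
  count-cong λ e → cong (λ b → ⌊ (if b then proj₂ (ends e) else proj₁ (ends e)) ≟ v ⌋) (O≗O′ e)
  where open Graph G

Compatible-cong : ∀ G {O O′ : Orientation G} {c} → (∀ e → O e ≡ O′ e) →
                  Compatible G O c → Compatible G O′ c
Compatible-cong G O≗O′ compatible i = subst (_ ≤_) (indeg-cong G O≗O′ (suc i)) (compatible i)

pairOrientation-combine : ∀ m (O : Orientation (K m)) e →
                          O e ≡ pairOrientation m (λ i j → O (combine i j)) e
pairOrientation-combine m O e = cong O (sym (combine-remQuot {m} 2 e))

-- A configuration of K (suc k) is indexed by i : Fin (suc (suc k)) standing for the vertex suc i;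
-- thus small t and bigIndex k j index the vertices small (suc t) and bigPart (suc k) j.
bigIndex : ∀ k → Fin 2 → Fin (suc (suc k))
bigIndex k zero       = inject₁ (fromℕ k)
bigIndex k (suc zero) = fromℕ (suc k)

suc-bigIndex : ∀ k j → suc (bigIndex k j) ≡ bigPart (suc k) j
suc-bigIndex k zero       = refl
suc-bigIndex k (suc zero) = refl

nonSink-elim : ∀ k {Q : Fin (suc (suc k)) → Set} →
               (∀ t → Q (small t)) → (∀ j → Q (bigIndex k j)) → ∀ i → Q i
nonSink-elim zero    Qs Qb zero       = Qb zero
nonSink-elim zero    Qs Qb (suc zero) = Qb (suc zero)
nonSink-elim (suc k) Qs Qb zero       = Qs zero
nonSink-elim (suc k) Qs Qb (suc i)    =
  nonSink-elim k (Qs ∘ suc) (λ { zero → Qb zero ; (suc zero) → Qb (suc zero) }) i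

module _ (k : ℕ) (c : Config (K (suc k))) where

  deg-bigIndex : ∀ j → deg (K (suc k)) (suc (bigIndex k j)) ≡ suc k
  deg-bigIndex j = trans (cong (deg (K (suc k))) (suc-bigIndex k j)) (deg-big (suc k) j)

  Stable-K⇔ : Stable (K (suc k)) c ⇔ ((∀ t → c (small t) ≤ 1) × (∀ j → c (bigIndex k j) ≤ k))
  Stable-K⇔ = mk⇔
    (λ stable → (λ t → ≤-pred (subst (c (small t) <_) (deg-small _ (suc t)) (stable (small t))))
              , (λ j → ≤-pred (subst (c (bigIndex k j) <_) (deg-bigIndex j) (stable (bigIndex k j)))))
    (λ (small≤1 , big≤k) → nonSink-elim k
       (λ t → subst (c (small t) <_) (sym (deg-small _ (suc t))) (s≤s (small≤1 t)))
       (λ j → subst (c (bigIndex k j) <_) (sym (deg-bigIndex j)) (s≤s (big≤k j))))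

  Compatible-pair⇔ : ∀ P → Compatible (K (suc k)) (pairOrientation (suc k) P) c ⇔
                     ((∀ t → count (P (suc t)) ≤ c (small t)) ×
                      (∀ j → suc k ∸ c (bigIndex k j) ≤ count (λ i → P i j)))
  Compatible-pair⇔ P = mk⇔
    (λ compatible → (λ t → to (at-small t) (compatible (small t)))
                  , (λ j → to (at-big j) (compatible (bigIndex k j))))
    (λ (rows , columns) → nonSink-elim k (λ t → from (at-small t) (rows t))
                                         (λ j → from (at-big j) (columns j)))
    where
    open Equivalence
    O = pairOrientation (suc k) P
    CompatibleAt : Fin (suc (suc k)) → Set
    CompatibleAt i = deg (K (suc k)) (suc i) ∸ c i ≤ indeg (K (suc k)) O (suc i)
    at-vertex : ∀ {i d n} {A : Set} →
                deg (K (suc k)) (suc i) ≡ d → indeg (K (suc k)) O (suc i) ≡ n →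
                (d ∸ c i ≤ n ⇔ A) → CompatibleAt i ⇔ A
    at-vertex refl refl A⇔ = A⇔
    at-small : ∀ t → CompatibleAt (small t) ⇔ count (P (suc t)) ≤ c (small t)
    at-small t = at-vertex (deg-small (suc k) (suc t)) (indeg-pair-small (suc k) P (suc t))
                   (count-not-≥⇔count-≤ (P (suc t)) (c (small t)))
    at-big : ∀ j → CompatibleAt (bigIndex k j) ⇔ suc k ∸ c (bigIndex k j) ≤ count (λ i → P i j)
    at-big j = at-vertex (deg-bigIndex j)
                 (trans (cong (indeg (K (suc k)) O) (suc-bigIndex k j)) (indeg-pair-big (suc k) P j))
                 (⇔-id _)

proposition7 : (k : ℕ) (c : Fin (suc (suc k)) → ℕ) →
    Sto (K (suc k)) c ⇔
      ((∀ (i : Fin k) → c (inject₁ (inject₁ i)) ≤ 1)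
        × c (inject₁ (fromℕ k)) ≤ k
        × c (fromℕ (suc k)) ≤ k
        × k + count (λ i → c (inject₁ (inject₁ i)) ≡ᵇ 0)
            ≤ c (inject₁ (fromℕ k)) + c (fromℕ (suc k)))
proposition7 k c = mk⇔
  (λ (stable , O , compatible) →
    let (small≤1 , big≤k) = Equivalence.to (Stable-K⇔ k c) stable
        P = λ i j → O (combine i j)
        compatible′ = Compatible-cong (K (suc k)) {c = c} (pairOrientation-combine (suc k) O) compatible
        (rows , columns) = Equivalence.to (Compatible-pair⇔ k c P) compatible′
        deficit≤ = λ j → ∸-≤-count-tail (λ i → P i j) (big≤k j) (columns j)
    in small≤1 , big≤k zero , big≤k (suc zero) ,
       Equivalence.to (balance⇔ (big≤k zero) (big≤k (suc zero)))
         (≤-trans (+-monoˡ-≤ X (+-mono-≤ (deficit≤ zero) (deficit≤ (suc zero))))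
                  (column-counts-≤ (c ∘ small) (P ∘ suc) small≤1 rows)))
  (λ (small≤1 , cA≤k , cB≤k , balanced) →
    let (h , rows , columnA , columnB) =
          column-counts-realisable (c ∘ small) (Equivalence.from (balance⇔ cA≤k cB≤k) balanced)
        P = (λ _ → true) ∷ h
    in Equivalence.from (Stable-K⇔ k c) (small≤1 , λ { zero → cA≤k ; (suc zero) → cB≤k }) ,
       pairOrientation (suc k) P ,
       Equivalence.from (Compatible-pair⇔ k c P)
         (rows , λ { zero       → ∸-≤-count-true∷ (λ t → h t zero) cA≤k columnA
                   ; (suc zero) → ∸-≤-count-true∷ (λ t → h t (suc zero)) cB≤k columnB }))
  where
  X : ℕ
  X = count (idle (c ∘ small))
  balance⇔ : ∀ {cA cB} → cA ≤ k → cB ≤ k →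
             (k ∸ cA + (k ∸ cB) + X ≤ k ⇔ k + X ≤ cA + cB)
  balance⇔ = m∸n+[m∸o]+p≤m⇔m+p≤n+o
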